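{- For all integers $n\ge 0$ and $k\ge 0$, the number of circular permutations in $S_{n+1}$ having exactly $k$ large circular descents equals the Eulerian number $a(n,k)$.
   Context: A circular permutation in $S_m$ is an $m$-cycle, written $(a_1\cdots a_m)$ (meaning $a_1\mapsto a_2\mapsto\cdots\mapsto a_m\mapsto a_1$). A large circular descent of $(a_1\cdots a_m)$ is a letter $a_i$ such that $a_{i-1}>a_i+1$, indices taken modulo $m$ (this does not depend on the chosen cyclic representation). The Eulerian number $a(n,k)$ is the number of permutations $\sigma\in S_n$ with exactly $k$ descents, i.e. with $|\{i:1\le i\le n-1,\ \sigma(i)>\sigma(i+1)\}|=k$ (with $a(0,0)=1$, $a(0,k)=0$ for $k\ge1$). -}

module Defs where

open import Data.Nat using (ℕ; zero; suc; _+_; _<_; _<?_)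
open import Data.Bool using (if_then_else_)
open import Relation.Nullary.Decidable using (⌊_⌋)
open import Data.Nat.Properties using () 
open import Data.Fin using (Fin; toℕ) renaming (zero to fzero)
open import Data.Fin.Properties using () renaming (_≟_ to _≟ᶠ_)
open import Data.Vec using (Vec; []; _∷_; lookup; toList)
open import Data.List using (List; []; _∷_; [_]; map; concatMap; length; filter; allFin; upTo)
open import Data.List.Relation.Unary.All using (All; all?)
open import Data.List.Relation.Unary.Any using (Any; any?)
open import Data.List.Relation.Unary.AllPairs using (AllPairs; allPairs?)
open import Data.Product using (_×_)
open import Relation.Nullary using (Dec; yes; no; ¬_; ¬?)
open import Relation.Nullary.Decidable using (_×-dec_)
open import Relation.Binary.PropositionalEquality using (_≡_; _≢_)
open import Data.Nat using () renaming (_≟_ to _≟ℕ_)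

allVecs : ∀ {a} {A : Set a} → List A → (n : ℕ) → List (Vec A n)
allVecs xs zero    = [ [] ]
allVecs xs (suc n) = concatMap (λ x → map (x ∷_) (allVecs xs n)) xs

allMaps : (m : ℕ) → List (Vec (Fin m) m)
allMaps m = allVecs (allFin m) m

-- σ ∈ S_m : the one-line word has pairwise distinct entries (hence is a bijection).
IsPerm : ∀ {m} → Vec (Fin m) m → Set
IsPerm σ = AllPairs _≢_ (toList σ)

isPerm? : ∀ {m} (σ : Vec (Fin m) m) → Dec (IsPerm σ)
isPerm? σ = allPairs? (λ x y → ¬? (x ≟ᶠ y)) (toList σ)

desList : ∀ {m} → List (Fin m) → ℕ
desList []           = 0
desList (x ∷ [])     = 0
desList (x ∷ y ∷ w) = isDesc x y + desList (y ∷ w)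
  where
  isDesc : Fin _ → Fin _ → ℕ
  isDesc a b = if ⌊ toℕ b <? toℕ a ⌋ then 1 else 0

des : ∀ {n} → Vec (Fin n) n → ℕ
des σ = desList (toList σ)

eulerian : ℕ → ℕ → ℕ
eulerian n k = length (filter (λ σ → isPerm? σ ×-dec (des σ ≟ℕ k)) (allMaps n))

iter : ∀ {m} → Vec (Fin m) m → ℕ → Fin m → Fin m
iter σ zero    x = x
iter σ (suc i) x = lookup σ (iter σ i x)

-- σ ∈ S_(suc n) is an (n+1)-cycle: σ is a permutation and the orbit of 0 is all of [n+1]
-- (i.e. σ = (0 σ(0) σ²(0) … σⁿ(0)) is a single cycle through every letter).
IsCircular : ∀ {n} → Vec (Fin (suc n)) (suc n) → Set
IsCircular {n} σ = IsPerm σ × All (λ y → Any (λ i → iter σ i fzero ≡ y) (upTo (suc n))) (allFin (suc n))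

isCircular? : ∀ {n} (σ : Vec (Fin (suc n)) (suc n)) → Dec (IsCircular σ)
isCircular? {n} σ = isPerm? σ ×-dec all? (λ y → any? (λ i → iter σ i fzero ≟ᶠ y) (upTo (suc n))) (allFin (suc n))

-- Large circular descents of the cycle (a_1 … a_m): letters a_i with a_{i-1} > a_i + 1.
-- Since σ(a_{i-1}) = a_i, these are in bijection with the letters b = a_{i-1} satisfying
-- b > σ(b) + 1; we count letters b of the cycle by their predecessor position.
lcdes : ∀ {m} → Vec (Fin m) m → ℕ
lcdes {m} σ = length (filter (λ b → suc (toℕ (lookup σ b)) <? toℕ b) (allFin m))

circCount : ℕ → ℕ → ℕ
circCount n k = length (filter (λ σ → isCircular? σ ×-dec (lcdes σ ≟ℕ k)) (allMaps (suc n)))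

module Submission where

-- Writing a circular permutation as (0 a₁ ⋯ aₙ), its large circular descents are the large descents
-- of the word (a₁ − 1) ⋯ (aₙ − 1) over {0, …, n − 1} followed by a sentinel −1, so it suffices to show
-- that descents and large descents are equidistributed on such words. Every word arises uniquely by
-- inserting the largest letter n into a word of length n, and for either statistic with value d exactly
-- d + 1 of the n + 1 insertions keep it while the others raise it to d + 1. So both distributions obey
-- the same recursion and coincide.

open import Defs
open import Data.Nat using (ℕ)
open import Relation.Binary.PropositionalEquality using (_≡_)

open import Data.Nat using (zero; suc; pred; ≢-nonZero; _+_; _∸_; _≤_; _<_; z≤n; s≤s; _<?_) renaming (_≟_ to _≟ℕ_)
open import Data.Nat.Properties
  using (≤-trans; ≤-refl; ≤-reflexive; ≤-pred; <-irrefl; <-trans; <-asym; <⇒≤; n<1+n; n≤1+n;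
         ≤-<-trans; <-≤-trans; suc-injective; +-suc; +-comm; +-assoc; +-identityʳ; m+n∸m≡n; m≤n⇒m<n∨m≡n;
         0≢1+n; suc-pred)
open import Data.Fin using (Fin; toℕ; fromℕ<) renaming (zero to fzero; suc to fsuc)
open import Data.Fin.Properties using (toℕ-injective; toℕ<n; toℕ-fromℕ<) renaming (_≟_ to _≟ᶠ_)
open import Data.Vec using (Vec; []; _∷_; toList; lookup; head)
import Data.Vec.Properties as Vec
open import Data.Vec.Membership.Propositional.Properties using (∈-lookup; ∈-toList⁺)
open import Data.List
  using (List; []; _∷_; [_]; _++_; map; filter; length; concatMap; replicate; applyUpTo; upTo; downFrom; allFin)
open import Data.List.Properties
  using (length-map; length-applyUpTo; length-upTo; length-downFrom; length-tabulate;
         map-∘; map-++; map-replicate; filter-notAll; filter-all; filter-accept; filter-reject; filter-none; filter-++;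
         map-concatMap; concatMap-map; ∷-injectiveˡ; ∷-injectiveʳ; map-injective)
open import Data.List.Membership.Propositional using (_∈_; _∉_; find)
open import Data.List.Membership.Propositional.Properties
  using (∈-filter⁺; ∈-filter⁻; ∈-map⁺; ∈-map⁻; ∈-concatMap⁺; ∈-concatMap⁻; ∈-∃++;
         ∈-allFin; ∈-upTo⁺; ∈-upTo⁻; ∈-downFrom⁺; ∈-downFrom⁻)
open import Data.List.Membership.Propositional.Properties.WithK using (unique∧set⇒bag)
open import Data.List.Relation.Binary.Subset.Propositional using (_⊆_)
open import Data.List.Relation.Unary.Any using (Any; here; there)
import Data.List.Relation.Unary.Any as Any
import Data.List.Relation.Unary.Any.Properties as Any
open import Data.List.Relation.Unary.All using (All; []; _∷_)
import Data.List.Relation.Unary.All as All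
import Data.List.Relation.Unary.All.Properties as All
open import Data.List.Relation.Unary.Unique.Propositional using (Unique; []; _∷_)
import Data.List.Relation.Unary.Unique.Propositional.Properties as Unique
open import Data.List.Relation.Binary.Permutation.Propositional
  using (_↭_; ↭-refl; ↭-sym; ↭-trans; ↭-prep; ↭-reflexive; ↭⇒↭ₛ; prep; swap; module PermutationReasoning)
  renaming (refl to ↭-refl′; trans to ↭-trans′)
open import Data.List.Relation.Binary.Permutation.Propositional.Properties
  using (shift; shifts; drop-mid; ++⁺; ++⁺ˡ; All-resp-↭; ∈-resp-↭; ↭-length; filter-↭; ↭-empty-inv)
  renaming (map⁺ to ↭-map⁺)
import Data.List.Relation.Binary.Permutation.Setoid.Properties as Permutationₛ
open import Data.List.Relation.Binary.BagAndSetEquality using (∼bag⇒↭)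
open import Data.Product using (∃; _×_; _,_; proj₁; proj₂)
open import Data.Sum using (inj₁; inj₂)
open import Data.Empty using (⊥-elim)
open import Function.Base using (_∘_; id)
open import Function.Bundles using (mk⇔)
open import Relation.Nullary using (¬_; Dec; yes; no; ¬?)
open import Relation.Nullary.Decidable using (⌊_⌋; _×-dec_)
open import Data.Bool using (if_then_else_)
open import Relation.Binary.Definitions using (DecidableEquality)
open import Relation.Binary.PropositionalEquality using (_≢_; refl; sym; trans; cong; cong₂; subst; setoid; module ≡-Reasoning)

-- Duplicate-free lists and counting

module _ {A : Set} where

  Unique-resp-↭ : ∀ {xs ys : List A} → xs ↭ ys → Unique xs → Unique ys
  Unique-resp-↭ p = Permutationₛ.Unique-resp-↭ (setoid A) (↭⇒↭ₛ p)

  Unique∧⊆∧⊇⇒↭ : ∀ {xs ys : List A} → Unique xs → Unique ys → xs ⊆ ys → ys ⊆ xs → xs ↭ ys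
  Unique∧⊆∧⊇⇒↭ ux uy sub sup = ∼bag⇒↭ (unique∧set⇒bag ux uy (mk⇔ sub sup))

module _ {A : Set} (_≟_ : DecidableEquality A) where

  private
    _≢?_ : (x y : A) → Dec (x ≢ y)
    x ≢? y = ¬? (x ≟ y)

  Unique∧⊆⇒length≤ : ∀ {xs ys : List A} → Unique xs → xs ⊆ ys → length xs ≤ length ys
  Unique∧⊆⇒length≤ {[]} _ _ = z≤n
  Unique∧⊆⇒length≤ {x ∷ xs} {ys} (x∉xs ∷ u) sub =
    ≤-trans (s≤s (Unique∧⊆⇒length≤ u sub′))
            (filter-notAll (x ≢?_) ys (Any.map (λ x≡y x≢y → x≢y x≡y) (sub (here refl))))
    where
    sub′ : xs ⊆ filter (x ≢?_) ys
    sub′ z∈xs = ∈-filter⁺ (x ≢?_) (sub (there z∈xs)) (All.lookup x∉xs z∈xs)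

  length≤1+length-filter-≢ : ∀ x {ys : List A} → Unique ys → length ys ≤ suc (length (filter (x ≢?_) ys))
  length≤1+length-filter-≢ x {[]} _ = z≤n
  length≤1+length-filter-≢ x {y ∷ ys} (y∉ys ∷ u) with x ≟ y
  ... | yes refl = s≤s (≤-reflexive (cong length (sym (filter-all (x ≢?_) y∉ys))))
  ... | no _ = s≤s (length≤1+length-filter-≢ x u)

  ⊇∧length≤⇒Unique : ∀ {xs ys : List A} → Unique ys → ys ⊆ xs → length xs ≤ length ys → Unique xs
  ⊇∧length≤⇒Unique {[]} _ _ _ = []
  ⊇∧length≤⇒Unique {x ∷ xs} {ys} uy sup len with Any.any? (x ≟_) xs
  ... | yes x∈xs = ⊥-elim (<-irrefl refl (≤-trans len (Unique∧⊆⇒length≤ uy sup′)))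
    where
    sup′ : ys ⊆ xs
    sup′ y∈ys with sup y∈ys
    ... | here refl = x∈xs
    ... | there y∈xs = y∈xs
  ... | no x∉xs = All.¬Any⇒All¬ xs x∉xs ∷ ⊇∧length≤⇒Unique (Unique.filter⁺ (x ≢?_) uy) sup′
                    (≤-pred (≤-trans len (length≤1+length-filter-≢ x uy)))
    where
    sup′ : filter (x ≢?_) ys ⊆ xs
    sup′ y∈ with ∈-filter⁻ (x ≢?_) y∈
    ... | y∈ys , x≢y with sup y∈ys
    ... | here y≡x = ⊥-elim (x≢y (sym y≡x))
    ... | there y∈xs = y∈xs

  Unique∧⊆∧length≤⇒⊇ : ∀ {xs ys : List A} → Unique xs → xs ⊆ ys → length ys ≤ length xs → ys ⊆ xs
  Unique∧⊆∧length≤⇒⊇ {xs} {ys} ux sub len {y} y∈ys with Any.any? (y ≟_) xs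
  ... | yes y∈xs = y∈xs
  ... | no y∉xs = ⊥-elim (<-irrefl refl (≤-<-trans (Unique∧⊆⇒length≤ ux sub′) (<-≤-trans shorter len)))
    where
    sub′ : xs ⊆ filter (y ≢?_) ys
    sub′ {z} z∈xs = ∈-filter⁺ (y ≢?_) (sub z∈xs) (λ { refl → y∉xs z∈xs })
    shorter : length (filter (y ≢?_) ys) < length ys
    shorter = filter-notAll (y ≢?_) ys (Any.map (λ y≡z y≢z → y≢z y≡z) y∈ys)

module _ {A B : Set} (f : A → B) where

  InjectiveOn : List A → Set
  InjectiveOn xs = ∀ {x y} → x ∈ xs → y ∈ xs → f x ≡ f y → x ≡ y

  map-Unique⁺ : ∀ {xs} → Unique xs → InjectiveOn xs → Unique (map f xs)
  map-Unique⁺ {[]} _ _ = []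
  map-Unique⁺ {x ∷ xs} (x∉xs ∷ u) inj =
    All.map⁺ (All.tabulate (λ y∈xs fx≡fy → All.lookup x∉xs y∈xs (inj (here refl) (there y∈xs) fx≡fy)))
    ∷ map-Unique⁺ u (λ p q → inj (there p) (there q))

  Unique-map⇒InjectiveOn : ∀ {xs} → Unique (map f xs) → InjectiveOn xs
  Unique-map⇒InjectiveOn (_ ∷ _) (here refl) (here refl) _ = refl
  Unique-map⇒InjectiveOn (fx∉ ∷ _) (here refl) (there y∈xs) eq = ⊥-elim (All.lookup fx∉ (∈-map⁺ f y∈xs) eq)
  Unique-map⇒InjectiveOn (fy∉ ∷ _) (there x∈xs) (here refl) eq = ⊥-elim (All.lookup fy∉ (∈-map⁺ f x∈xs) (sym eq))
  Unique-map⇒InjectiveOn (_ ∷ u) (there x∈xs) (there y∈xs) eq = Unique-map⇒InjectiveOn u x∈xs y∈xs eq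

  length-≡-by-bijection : ∀ {xs ys} → Unique xs → Unique ys → InjectiveOn xs →
    (∀ {x} → x ∈ xs → f x ∈ ys) → (∀ {y} → y ∈ ys → ∃ λ x → x ∈ xs × f x ≡ y) →
    length xs ≡ length ys
  length-≡-by-bijection {xs} {ys} ux uy inj into onto =
    trans (sym (length-map f xs)) (↭-length (Unique∧⊆∧⊇⇒↭ (map-Unique⁺ ux inj) uy into′ onto′))
    where
    into′ : map f xs ⊆ ys
    into′ y∈ with ∈-map⁻ f y∈
    ... | x , x∈xs , refl = into x∈xs
    onto′ : ys ⊆ map f xs
    onto′ y∈ys with onto y∈ys
    ... | x , x∈xs , refl = ∈-map⁺ f x∈xs

  length-filter-map : ∀ {p} {P : B → Set p} (P? : ∀ y → Dec (P y)) xs →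
    length (filter P? (map f xs)) ≡ length (filter (λ x → P? (f x)) xs)
  length-filter-map P? [] = refl
  length-filter-map P? (x ∷ xs) with P? (f x)
  ... | yes _ = cong suc (length-filter-map P? xs)
  ... | no _ = length-filter-map P? xs

module _ {A B : Set} (f : A → List B) where

  concatMap-Unique⁺ : ∀ (r : B → A) {xs} → Unique xs → (∀ {x} → x ∈ xs → Unique (f x)) →
    (∀ {x w} → x ∈ xs → w ∈ f x → r w ≡ x) → Unique (concatMap f xs)
  concatMap-Unique⁺ r {[]} _ _ _ = []
  concatMap-Unique⁺ r {x ∷ xs} (x∉xs ∷ u) uf ret =
    Unique.++⁺ (uf (here refl)) (concatMap-Unique⁺ r u (uf ∘ there) (ret ∘ there)) disjoint
    where
    disjoint : ∀ {w} → ¬ (w ∈ f x × w ∈ concatMap f xs)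
    disjoint (w∈fx , w∈rest) with find (∈-concatMap⁻ f {xs = xs} w∈rest)
    ... | x′ , x′∈xs , w∈fx′ =
      All.lookup x∉xs x′∈xs (trans (sym (ret (here refl) w∈fx)) (ret (there x′∈xs) w∈fx′))

  concatMap-↭ : ∀ {xs ys} → xs ↭ ys → concatMap f xs ↭ concatMap f ys
  concatMap-↭ ↭-refl′ = ↭-refl
  concatMap-↭ (prep x p) = ++⁺ˡ (f x) (concatMap-↭ p)
  concatMap-↭ (swap x y p) = ↭-trans (shifts (f x) (f y)) (++⁺ˡ (f y) (++⁺ˡ (f x) (concatMap-↭ p)))
  concatMap-↭ (↭-trans′ p q) = ↭-trans (concatMap-↭ p) (concatMap-↭ q)

concatMap-↭-pointwise : ∀ {A B : Set} {f g : A → List B} xs → (∀ {x} → x ∈ xs → f x ↭ g x) →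
  concatMap f xs ↭ concatMap g xs
concatMap-↭-pointwise [] _ = ↭-refl
concatMap-↭-pointwise (x ∷ xs) f↭g = ++⁺ (f↭g (here refl)) (concatMap-↭-pointwise xs (f↭g ∘ there))

-- Permutation words by insertion

insertions : ℕ → List ℕ → List (List ℕ)
insertions x [] = [ [ x ] ]
insertions x (y ∷ ys) = (x ∷ y ∷ ys) ∷ map (y ∷_) (insertions x ys)

perms : ℕ → List (List ℕ)
perms zero = [ [] ]
perms (suc n) = concatMap (insertions n) (perms n)

∈-insertions⁻ : ∀ {x τ w} → w ∈ insertions x τ → ∃ λ pre → ∃ λ post → τ ≡ pre ++ post × w ≡ pre ++ x ∷ post
∈-insertions⁻ {τ = []} (here refl) = [] , [] , refl , refl
∈-insertions⁻ {τ = y ∷ ys} (here refl) = [] , y ∷ ys , refl , refl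
∈-insertions⁻ {τ = y ∷ ys} (there w∈) with ∈-map⁻ (y ∷_) w∈
... | w′ , w′∈ , refl with ∈-insertions⁻ w′∈
... | pre , post , refl , refl = y ∷ pre , post , refl , refl

∈-insertions⁺ : ∀ x pre post → pre ++ x ∷ post ∈ insertions x (pre ++ post)
∈-insertions⁺ x [] [] = here refl
∈-insertions⁺ x [] (y ∷ post) = here refl
∈-insertions⁺ x (y ∷ pre) post = there (∈-map⁺ (y ∷_) (∈-insertions⁺ x pre post))

∈-insertions⇒↭ : ∀ {x τ w} → w ∈ insertions x τ → w ↭ x ∷ τ
∈-insertions⇒↭ w∈ with ∈-insertions⁻ w∈
... | pre , post , refl , refl = shift _ pre post

insertions-Unique : ∀ {x τ} → x ∉ τ → Unique (insertions x τ)
insertions-Unique {τ = []} _ = [] ∷ []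
insertions-Unique {τ = y ∷ ys} x∉ =
  All.map⁺ (All.tabulate (λ _ eq → x∉ (here (∷-injectiveˡ eq))))
  ∷ Unique.map⁺ ∷-injectiveʳ (insertions-Unique (x∉ ∘ there))

remove : ℕ → List ℕ → List ℕ
remove x = filter (λ z → ¬? (x ≟ℕ z))

remove-insertions : ∀ {x τ w} → x ∉ τ → w ∈ insertions x τ → remove x w ≡ τ
remove-insertions {x} x∉ w∈ with ∈-insertions⁻ w∈
... | pre , post , refl , refl = begin
  remove x (pre ++ x ∷ post)     ≡⟨ filter-++ x≢? pre (x ∷ post) ⟩
  remove x pre ++ remove x (x ∷ post) ≡⟨ cong (remove x pre ++_) (filter-reject x≢? (λ x≢x → x≢x refl)) ⟩
  remove x pre ++ remove x post  ≡⟨ filter-++ x≢? pre post ⟨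
  remove x (pre ++ post)         ≡⟨ filter-all x≢? (All.tabulate λ { z∈ refl → x∉ z∈ }) ⟩
  pre ++ post                    ∎
  where
  open ≡-Reasoning
  x≢? = λ z → ¬? (x ≟ℕ z)

∈-perms⇒↭ : ∀ {n w} → w ∈ perms n → w ↭ downFrom n
∈-perms⇒↭ {zero} (here refl) = ↭-refl
∈-perms⇒↭ {suc n} w∈ with find (∈-concatMap⁻ (insertions n) {xs = perms n} w∈)
... | τ , τ∈ , w∈ins = ↭-trans (∈-insertions⇒↭ w∈ins) (↭-prep n (∈-perms⇒↭ τ∈))

↭⇒∈-perms : ∀ {n w} → w ↭ downFrom n → w ∈ perms n
↭⇒∈-perms {zero} w↭ with ↭-empty-inv w↭
... | refl = here refl
↭⇒∈-perms {suc n} {w} w↭ with ∈-∃++ (∈-resp-↭ (↭-sym w↭) (here refl))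
... | pre , post , refl =
  ∈-concatMap⁺ (insertions n) (Any.map (λ { refl → ∈-insertions⁺ n pre post }) (↭⇒∈-perms (drop-mid pre [] w↭)))

∈-perms⇒Unique : ∀ {n w} → w ∈ perms n → Unique w
∈-perms⇒Unique {n} w∈ = Unique-resp-↭ (↭-sym (∈-perms⇒↭ w∈)) (Unique.downFrom⁺ n)

∈-perms⇒All< : ∀ {n w} → w ∈ perms n → All (_< n) w
∈-perms⇒All< {n} w∈ = All-resp-↭ (↭-sym (∈-perms⇒↭ w∈)) (All.tabulate ∈-downFrom⁻)

∈-perms⇒length : ∀ {n w} → w ∈ perms n → length w ≡ n
∈-perms⇒length {n} w∈ = trans (↭-length (∈-perms⇒↭ {n} w∈)) (length-downFrom n)

perms-Unique : ∀ n → Unique (perms n)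
perms-Unique zero = [] ∷ []
perms-Unique (suc n) =
  concatMap-Unique⁺ (insertions n) (remove n) (perms-Unique n)
    (λ τ∈ → insertions-Unique (n∉ τ∈)) (λ τ∈ → remove-insertions (n∉ τ∈))
  where
  n∉ : ∀ {τ} → τ ∈ perms n → n ∉ τ
  n∉ τ∈ n∈ = <-irrefl refl (All.lookup (∈-perms⇒All< τ∈) n∈)

Unique∧All<⇒∈-perms : ∀ {n w} → Unique w → All (_< n) w → length w ≡ n → w ∈ perms n
Unique∧All<⇒∈-perms {n} {w} uw w<n len = ↭⇒∈-perms (Unique∧⊆∧⊇⇒↭ uw (Unique.downFrom⁺ n) w⊆ w⊇)
  where
  w⊆ : w ⊆ downFrom n
  w⊆ v∈ = ∈-downFrom⁺ (All.lookup w<n v∈)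
  w⊇ : downFrom n ⊆ w
  w⊇ = Unique∧⊆∧length≤⇒⊇ _≟ℕ_ uw w⊆ (≤-reflexive (trans (length-downFrom n) (sym len)))

-- Descents and large descents under insertion

𝟙[_] : ∀ {p} {P : Set p} → Dec P → ℕ
𝟙[ yes _ ] = 1
𝟙[ no _ ] = 0

descents : List ℕ → ℕ
descents [] = 0
descents (x ∷ []) = 0
descents (x ∷ y ∷ w) = 𝟙[ y <? x ] + descents (y ∷ w)

-- The word is read as followed by the sentinel letter −1, so its last letter counts iff it is positive.
largeDescents : List ℕ → ℕ
largeDescents [] = 0
largeDescents (x ∷ []) = 𝟙[ 0 <? x ]
largeDescents (x ∷ y ∷ w) = 𝟙[ suc y <? x ] + largeDescents (y ∷ w)

nonLargeAfter : ℕ → List ℕ → ℕ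
nonLargeAfter x ys = length (filter (λ z → ¬? (suc z <? x)) ys)

nonLargeAfter-∷ : ∀ x z zs → nonLargeAfter x (z ∷ zs) ≡ 𝟙[ ¬? (suc z <? x) ] + nonLargeAfter x zs
nonLargeAfter-∷ x z zs with suc z <? x
... | yes large = cong length (filter-reject (λ z → ¬? (suc z <? x)) (λ not-large → not-large large))
... | no not-large = cong length (filter-accept (λ z → ¬? (suc z <? x)) not-large)

spread : ℕ → ℕ → ℕ → List ℕ
spread d a b = replicate a d ++ replicate b (suc d)

-- d + 1 of the n + 1 ways of inserting a new largest letter keep the statistic d, the others raise it by one
insertionSpectrum : ℕ → ℕ → List ℕ
insertionSpectrum n d = spread d (suc d) (n ∸ d)

spread-raise : ∀ {d} a {b M} → M ↭ spread d a b → suc d ∷ M ↭ spread d a (suc b)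
spread-raise {d} a {b} M↭ = ↭-trans (↭-prep (suc d) M↭) (↭-sym (shift (suc d) (replicate a d) (replicate b (suc d))))

map-suc-spread : ∀ d a b → map suc (spread d a b) ≡ spread (suc d) a b
map-suc-spread d a b =
  trans (map-++ suc (replicate a d) (replicate b (suc d))) (cong₂ _++_ (map-replicate suc a d) (map-replicate suc b (suc d)))

map-suc-↭-spread : ∀ {M d a b} → M ↭ spread d a b → map suc M ↭ spread (suc d) a b
map-suc-↭-spread {M} {d} {a} {b} M↭ = subst (map suc M ↭_) (map-suc-spread d a b) (↭-map⁺ suc M↭)

m+n≡o⇒o∸m≡n : ∀ m {n o} → m + n ≡ o → o ∸ m ≡ n
m+n≡o⇒o∸m≡n m {n} refl = m+n∸m≡n m n

descents-insertions-after : ∀ x y ys → All (_< x) (y ∷ ys) →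
  let d = descents (y ∷ ys) in
  ∃ λ s → map (λ w → descents (y ∷ w)) (insertions x ys) ↭ spread d (suc d) s × d + s ≡ length ys
descents-insertions-after x y [] (y<x ∷ []) with x <? y
... | yes x<y = ⊥-elim (<-asym x<y y<x)
... | no _ = 0 , ↭-refl , refl
descents-insertions-after x y (z ∷ zs) (y<x ∷ z<x ∷ zs<x)
  with descents-insertions-after x z zs (z<x ∷ zs<x)
... | s , M↭ , eq rewrite sym (map-∘ {g = λ w → descents (y ∷ w)} {f = z ∷_} (insertions x zs))
  with x <? y | z <? x | z <? y
... | yes x<y | _ | _ = ⊥-elim (<-asym x<y y<x)
... | no _ | no z≮x | _ = ⊥-elim (z≮x z<x)
... | no _ | yes _ | yes _ =
  s , ↭-prep _ (↭-trans (↭-reflexive (map-∘ (insertions x zs))) (map-suc-↭-spread {a = suc (descents (z ∷ zs))} M↭)) ,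
  cong suc eq
... | no _ | yes _ | no _ = suc s , spread-raise (suc (descents (z ∷ zs))) M↭ , trans (+-suc _ s) (cong suc eq)

descents-insertions : ∀ x τ → All (_< x) τ → map descents (insertions x τ) ↭ insertionSpectrum (length τ) (descents τ)
descents-insertions x [] _ = ↭-refl
descents-insertions x (y ∷ ys) τ<x@(y<x ∷ _) with descents-insertions-after x y ys τ<x
... | s , M↭ , eq rewrite sym (map-∘ {g = descents} {f = y ∷_} (insertions x ys)) with y <? x
... | yes _ = subst (λ t → suc d ∷ M ↭ spread d (suc d) t) (sym (m+n≡o⇒o∸m≡n d d+1+s≡1+ys)) (spread-raise (suc d) M↭)
  where
  d = descents (y ∷ ys)
  d+1+s≡1+ys = trans (+-suc d s) (cong suc eq)
  M = map (λ w → descents (y ∷ w)) (insertions x ys)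
... | no y≮x = ⊥-elim (y≮x y<x)

spread-∷ : ∀ {P : Set} (D : Dec P) {b c s m M} → M ↭ spread b (b + c) s → b + c + s ≡ m →
  ∃ λ s′ → (𝟙[ D ] + b ∷ M ↭ spread b (b + (𝟙[ ¬? D ] + c)) s′) × b + (𝟙[ ¬? D ] + c) + s′ ≡ suc m
spread-∷ (yes _) {b} {c} {s} M↭ eq = suc s , spread-raise (b + c) M↭ , trans (+-suc (b + c) s) (cong suc eq)
spread-∷ (no _) {b} {c} {s} {M = M} M↭ eq =
  s , subst (λ t → b ∷ M ↭ spread b t s) (sym (+-suc b c)) (↭-prep b M↭) , trans (cong (_+ s) (+-suc b c)) (cong suc eq)

-- Inserting x in front of a letter z creates a large descent x z unless z + 1 ≥ x.
largeDescents-insertions-after : ∀ x y ys → All (_< x) (y ∷ ys) →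
  let b = largeDescents (y ∷ ys); c = nonLargeAfter x ys in
  ∃ λ s → map (λ w → largeDescents (y ∷ w)) (insertions x ys) ↭ spread b (b + c) s × b + c + s ≡ suc (length ys)
largeDescents-insertions-after x y [] (y<x ∷ []) with suc x <? y | 0 <? x | 0 <? y
... | yes x+1<y | _ | _ = ⊥-elim (<-asym (<-trans (n<1+n x) x+1<y) y<x)
... | no _ | no 0≮x | _ = ⊥-elim (0≮x (≤-<-trans z≤n y<x))
... | no _ | yes _ | yes _ = 0 , ↭-refl , refl
... | no _ | yes _ | no _ = 1 , ↭-refl , refl
largeDescents-insertions-after x y (z ∷ zs) (y<x ∷ z<x ∷ zs<x)
  with largeDescents-insertions-after x z zs (z<x ∷ zs<x)
... | s , M↭ , eq rewrite sym (map-∘ {g = λ w → largeDescents (y ∷ w)} {f = z ∷_} (insertions x zs)) | nonLargeAfter-∷ x z zs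
  with suc x <? y | suc z <? x | suc z <? y
... | yes x+1<y | _ | _ = ⊥-elim (<-asym (<-trans (n<1+n x) x+1<y) y<x)
... | no _ | no z+1≮x | yes z+1<y = ⊥-elim (z+1≮x (<-trans z+1<y y<x))
... | no _ | yes _ | yes _ =
  s , ↭-prep _ (↭-trans (↭-reflexive (map-∘ (insertions x zs))) (map-suc-↭-spread {a = b + c} M↭)) , cong suc eq
  where b = largeDescents (z ∷ zs); c = nonLargeAfter x zs
... | no _ | yes z+1<x | no _ = spread-∷ (yes z+1<x) M↭ eq
... | no _ | no z+1≮x | no _ = spread-∷ (no z+1≮x) M↭ eq

largeDescents-insertions : ∀ x τ → 0 < x → All (_< x) τ →
  let b = largeDescents τ; c = nonLargeAfter x τ in
  ∃ λ s → map largeDescents (insertions x τ) ↭ spread b (b + c) s × b + c + s ≡ suc (length τ)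
largeDescents-insertions x [] 0<x [] with 0 <? x
... | yes _ = 1 , ↭-refl , refl
... | no 0≮x = ⊥-elim (0≮x 0<x)
largeDescents-insertions x (y ∷ ys) _ τ<x with largeDescents-insertions-after x y ys τ<x
... | s , M↭ , eq rewrite sym (map-∘ {g = largeDescents} {f = y ∷_} (insertions x ys)) | nonLargeAfter-∷ x y ys =
  spread-∷ (suc y <? x) M↭ eq

nonLargeAfter-perms : ∀ {m τ} → τ ∈ perms (suc m) → nonLargeAfter (suc m) τ ≡ 1
nonLargeAfter-perms {m} {τ} τ∈ = begin
  length (filter P? τ)                     ≡⟨ ↭-length (filter-↭ P? (∈-perms⇒↭ τ∈)) ⟩
  length (filter P? (m ∷ downFrom m))      ≡⟨ cong length (filter-accept P? (<-irrefl refl)) ⟩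
  suc (length (filter P? (downFrom m)))    ≡⟨ cong (suc ∘ length) (filter-none P? (All.tabulate below)) ⟩
  1                                        ∎
  where
  open ≡-Reasoning
  P? = λ z → ¬? (suc z <? suc m)
  below : ∀ {z} → z ∈ downFrom m → ¬ ¬ suc z < suc m
  below z∈ not-large = not-large (s≤s (∈-downFrom⁻ z∈))

descents-insertions-perms : ∀ n {τ} → τ ∈ perms n → map descents (insertions n τ) ↭ insertionSpectrum n (descents τ)
descents-insertions-perms n {τ} τ∈ =
  subst (λ m → map descents (insertions n τ) ↭ insertionSpectrum m (descents τ)) (∈-perms⇒length τ∈)
        (descents-insertions n τ (∈-perms⇒All< τ∈))

largeDescents-insertions-perms : ∀ n {τ} → τ ∈ perms n →
  map largeDescents (insertions n τ) ↭ insertionSpectrum n (largeDescents τ)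
largeDescents-insertions-perms zero (here refl) = ↭-refl
largeDescents-insertions-perms (suc m) {τ} τ∈ with largeDescents-insertions (suc m) τ (s≤s z≤n) (∈-perms⇒All< τ∈)
... | s , M↭ , eq = subst (_ ↭_) (cong₂ (spread b) b+c≡1+b (sym (m+n≡o⇒o∸m≡n b b+s≡1+m))) M↭
  where
  open ≡-Reasoning
  b = largeDescents τ
  c≡1 = nonLargeAfter-perms τ∈
  b+c≡1+b : b + nonLargeAfter (suc m) τ ≡ suc b
  b+c≡1+b = trans (cong (b +_) c≡1) (+-comm b 1)
  b+s≡1+m : b + s ≡ suc m
  b+s≡1+m = suc-injective (begin
    suc (b + s)                          ≡⟨ +-suc b s ⟨
    b + suc s                            ≡⟨ +-assoc b 1 s ⟨
    b + 1 + s                            ≡⟨ cong (λ t → b + t + s) c≡1 ⟨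
    b + nonLargeAfter (suc m) τ + s      ≡⟨ eq ⟩
    suc (length τ)                       ≡⟨ cong suc (∈-perms⇒length τ∈) ⟩
    suc (suc m)                          ∎)

map-perms-suc : ∀ (stat : List ℕ → ℕ) n →
  (∀ {τ} → τ ∈ perms n → map stat (insertions n τ) ↭ insertionSpectrum n (stat τ)) →
  map stat (perms (suc n)) ↭ concatMap (insertionSpectrum n) (map stat (perms n))
map-perms-suc stat n spectrum = begin
  map stat (concatMap (insertions n) (perms n))               ≡⟨ map-concatMap stat (insertions n) (perms n) ⟩
  concatMap (map stat ∘ insertions n) (perms n)               ↭⟨ concatMap-↭-pointwise (perms n) spectrum ⟩
  concatMap (insertionSpectrum n ∘ stat) (perms n)            ≡⟨ concatMap-map (insertionSpectrum n) stat (perms n) ⟨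
  concatMap (insertionSpectrum n) (map stat (perms n))        ∎
  where open PermutationReasoning

descents↭largeDescents : ∀ n → map descents (perms n) ↭ map largeDescents (perms n)
descents↭largeDescents zero = ↭-refl
descents↭largeDescents (suc n) = begin
  map descents (perms (suc n))                                    ↭⟨ map-perms-suc descents n (descents-insertions-perms n) ⟩
  concatMap (insertionSpectrum n) (map descents (perms n))        ↭⟨ concatMap-↭ (insertionSpectrum n) (descents↭largeDescents n) ⟩
  concatMap (insertionSpectrum n) (map largeDescents (perms n))   ↭⟨ map-perms-suc largeDescents n (largeDescents-insertions-perms n) ⟨
  map largeDescents (perms (suc n))                               ∎
  where open PermutationReasoning

#perms-with : (List ℕ → ℕ) → ℕ → ℕ → ℕ
#perms-with stat n k = length (filter (λ w → stat w ≟ℕ k) (perms n))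

#perms-descents≡#perms-largeDescents : ∀ n k → #perms-with descents n k ≡ #perms-with largeDescents n k
#perms-descents≡#perms-largeDescents n k = begin
  #perms-with descents n k                                ≡⟨ length-filter-map descents (_≟ℕ k) (perms n) ⟨
  length (filter (_≟ℕ k) (map descents (perms n)))        ≡⟨ ↭-length (filter-↭ (_≟ℕ k) (descents↭largeDescents n)) ⟩
  length (filter (_≟ℕ k) (map largeDescents (perms n)))   ≡⟨ length-filter-map largeDescents (_≟ℕ k) (perms n) ⟩
  #perms-with largeDescents n k                           ∎
  where open ≡-Reasoning

-- Permutations in one-line notation

∈-allVecs : ∀ {A : Set} {xs : List A} → (∀ a → a ∈ xs) → ∀ n (v : Vec A n) → v ∈ allVecs xs n
∈-allVecs _ zero [] = here refl
∈-allVecs {xs = xs} all∈ (suc n) (a ∷ v) =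
  ∈-concatMap⁺ (λ x → map (x ∷_) (allVecs xs n))
    (Any.map (λ { refl → ∈-map⁺ (a ∷_) (∈-allVecs all∈ n v) }) (all∈ a))

allVecs-Unique : ∀ {A : Set} {xs : List A} → Unique xs → ∀ n → Unique (allVecs xs n)
allVecs-Unique _ zero = [] ∷ []
allVecs-Unique {xs = xs} u (suc n) =
  concatMap-Unique⁺ (λ x → map (x ∷_) (allVecs xs n)) head u
    (λ _ → Unique.map⁺ Vec.∷-injectiveʳ (allVecs-Unique u n)) head-∈
  where
  head-∈ : ∀ {x w} → x ∈ xs → w ∈ map (x ∷_) (allVecs xs n) → head w ≡ x
  head-∈ _ w∈ with ∈-map⁻ _ w∈
  ... | _ , _ , refl = refl

∈-allMaps : ∀ m (σ : Vec (Fin m) m) → σ ∈ allMaps m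
∈-allMaps m = ∈-allVecs ∈-allFin m

allMaps-Unique : ∀ m → Unique (allMaps m)
allMaps-Unique m = allVecs-Unique (Unique.allFin⁺ m) m

word : ∀ {m n} → Vec (Fin m) n → List ℕ
word v = map toℕ (toList v)

word-injective : ∀ {m n} (u v : Vec (Fin m) n) → word u ≡ word v → u ≡ v
word-injective u v eq = trans (sym (Vec.cast-is-id refl u)) (Vec.toList-injective refl u v (map-injective toℕ-injective eq))

word-All< : ∀ {m n} (v : Vec (Fin m) n) → All (_< m) (word v)
word-All< v = All.map⁺ (All.tabulate (λ {i} _ → toℕ<n i))

length-word : ∀ {m n} (v : Vec (Fin m) n) → length (word v) ≡ n
length-word v = trans (length-map toℕ (toList v)) (Vec.length-toList v)

word-surjective : ∀ {m n} w → All (_< m) w → length w ≡ n → ∃ λ (v : Vec (Fin m) n) → word v ≡ w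
word-surjective {n = zero} [] [] _ = [] , refl
word-surjective {n = suc n} (x ∷ w) (x<m ∷ w<m) len with word-surjective w w<m (suc-injective len)
... | v , refl = fromℕ< x<m ∷ v , cong (_∷ word v) (toℕ-fromℕ< x<m)

IsPerm⇒word∈perms : ∀ {n} (σ : Vec (Fin n) n) → IsPerm σ → word σ ∈ perms n
IsPerm⇒word∈perms σ perm = Unique∧All<⇒∈-perms (Unique.map⁺ toℕ-injective perm) (word-All< σ) (length-word σ)

desList-toℕ : ∀ {m} (w : List (Fin m)) → desList w ≡ descents (map toℕ w)
desList-toℕ [] = refl
desList-toℕ (x ∷ []) = refl
desList-toℕ (x ∷ y ∷ w) = cong₂ _+_ (if-𝟙 (toℕ y <? toℕ x)) (desList-toℕ (y ∷ w))
  where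
  if-𝟙 : ∀ {P : Set} (D : Dec P) → (if ⌊ D ⌋ then 1 else 0) ≡ 𝟙[ D ]
  if-𝟙 (yes _) = refl
  if-𝟙 (no _) = refl

eulerian≡#perms-descents : ∀ n k → eulerian n k ≡ #perms-with descents n k
eulerian≡#perms-descents n k =
  length-≡-by-bijection word (Unique.filter⁺ P? (allMaps-Unique n)) (Unique.filter⁺ Q? (perms-Unique n))
    (λ _ _ → word-injective _ _) into onto
  where
  P? = λ (σ : Vec (Fin n) n) → isPerm? σ ×-dec (des σ ≟ℕ k)
  Q? = λ w → descents w ≟ℕ k
  into : ∀ {σ} → σ ∈ filter P? (allMaps n) → word σ ∈ filter Q? (perms n)
  into {σ} σ∈ with ∈-filter⁻ P? {xs = allMaps n} σ∈
  ... | _ , perm , des≡k = ∈-filter⁺ Q? (IsPerm⇒word∈perms σ perm) (trans (sym (desList-toℕ (toList σ))) des≡k)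
  onto : ∀ {w} → w ∈ filter Q? (perms n) → ∃ λ σ → σ ∈ filter P? (allMaps n) × word σ ≡ w
  onto {w} w∈ with ∈-filter⁻ Q? {xs = perms n} w∈
  ... | w∈perms , des≡k with word-surjective w (∈-perms⇒All< w∈perms) (∈-perms⇒length w∈perms)
  ... | σ , word≡w =
    σ , ∈-filter⁺ P? (∈-allMaps n σ) (perm , trans (desList-toℕ (toList σ)) (trans (cong descents word≡w) des≡k)) , word≡w
    where
    perm : IsPerm σ
    perm = Unique.map⁻ (subst Unique (sym word≡w) (∈-perms⇒Unique {n} w∈perms))

-- Circular permutations and their cycle words

#below : ∀ {P : ℕ → Set} → (∀ j → Dec (P j)) → ℕ → ℕ
#below P? zero = 0
#below P? (suc n) = 𝟙[ P? 0 ] + #below (P? ∘ suc) n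

length-filter-applyUpTo : ∀ {A : Set} {P : A → Set} (P? : ∀ a → Dec (P a)) (f : ℕ → A) n →
  length (filter P? (applyUpTo f n)) ≡ #below (P? ∘ f) n
length-filter-applyUpTo P? f zero = refl
length-filter-applyUpTo P? f (suc n) with P? (f 0)
... | yes _ = cong suc (length-filter-applyUpTo P? (f ∘ suc) n)
... | no _ = length-filter-applyUpTo P? (f ∘ suc) n

𝟙-cong : ∀ {P Q : Set} → (P → Q) → (Q → P) → (D : Dec P) (E : Dec Q) → 𝟙[ D ] ≡ 𝟙[ E ]
𝟙-cong _ _ (yes _) (yes _) = refl
𝟙-cong p⇒q _ (yes p) (no ¬q) = ⊥-elim (¬q (p⇒q p))
𝟙-cong _ q⇒p (no ¬p) (yes q) = ⊥-elim (¬p (q⇒p q))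
𝟙-cong _ _ (no _) (no _) = refl

𝟙-no : ∀ {P : Set} (D : Dec P) → ¬ P → 𝟙[ D ] ≡ 0
𝟙-no (yes p) ¬p = ⊥-elim (¬p p)
𝟙-no (no _) _ = refl

𝟙-pred : ∀ {a b b′} → b ≡ suc b′ → 𝟙[ suc a <? b ] ≡ 𝟙[ a <? b′ ]
𝟙-pred refl = 𝟙-cong ≤-pred s≤s _ _

-- h lists the letters of a cycle 0 → h 0 → h 1 → ⋯ → h n = 0; g is the word h − 1 read off it
#below-largeDescents : ∀ n (g h : ℕ → ℕ) → (∀ j → j < n → h j ≡ suc (g j)) → h n ≡ 0 →
  #below (λ j → suc (h (suc j)) <? h j) n ≡ largeDescents (applyUpTo g n)
#below-largeDescents zero g h _ _ = refl
#below-largeDescents (suc zero) g h h≡ h1≡0 =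
  trans (+-identityʳ _) (trans (cong (λ a → 𝟙[ suc a <? h 0 ]) h1≡0) (𝟙-pred (h≡ 0 (s≤s z≤n))))
#below-largeDescents (suc (suc n)) g h h≡ hn≡0 =
  cong₂ _+_ (trans (cong (λ a → 𝟙[ suc a <? h 0 ]) (h≡ 1 (s≤s (s≤s z≤n)))) (𝟙-pred (h≡ 0 (s≤s z≤n))))
            (#below-largeDescents (suc n) (g ∘ suc) (h ∘ suc) (λ j j< → h≡ (suc j) (s≤s j<)) hn≡0)

Unique⇒lookup-injective : ∀ {A : Set} {n} (v : Vec A n) → Unique (toList v) → ∀ {a b} → lookup v a ≡ lookup v b → a ≡ b
Unique⇒lookup-injective (x ∷ v) _ {fzero} {fzero} _ = refl
Unique⇒lookup-injective (x ∷ v) (x∉ ∷ _) {fzero} {fsuc b} eq = ⊥-elim (All.lookup x∉ (∈-toList⁺ (∈-lookup b v)) eq)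
Unique⇒lookup-injective (x ∷ v) (x∉ ∷ _) {fsuc a} {fzero} eq = ⊥-elim (All.lookup x∉ (∈-toList⁺ (∈-lookup a v)) (sym eq))
Unique⇒lookup-injective (x ∷ v) (_ ∷ u) {fsuc a} {fsuc b} eq = cong fsuc (Unique⇒lookup-injective v u eq)

-- σ = (0 a₁ ⋯ aₙ) is encoded by the word (a₁ − 1) ⋯ (aₙ − 1)
cycleWord : ∀ {n} → Vec (Fin (suc n)) (suc n) → List ℕ
cycleWord {n} σ = applyUpTo (λ i → pred (toℕ (iter σ (suc i) fzero))) n

module Circular {n : ℕ} (σ : Vec (Fin (suc n)) (suc n)) (circ : IsCircular σ) where

  orbit : ℕ → Fin (suc n)
  orbit i = iter σ i fzero

  orbitList : List (Fin (suc n))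
  orbitList = map orbit (upTo (suc n))

  ∈-orbitList : ∀ y → y ∈ orbitList
  ∈-orbitList y = Any.map⁺ (Any.map sym (All.lookup (proj₂ circ) (∈-allFin y)))

  orbitList-Unique : Unique orbitList
  orbitList-Unique = ⊇∧length≤⇒Unique _≟ᶠ_ (Unique.allFin⁺ (suc n)) (λ {y} _ → ∈-orbitList y)
    (≤-reflexive (trans (length-map orbit (upTo (suc n))) (trans (length-upTo (suc n)) (sym (length-tabulate id)))))

  allFin↭orbitList : allFin (suc n) ↭ orbitList
  allFin↭orbitList =
    Unique∧⊆∧⊇⇒↭ (Unique.allFin⁺ (suc n)) orbitList-Unique (λ {y} _ → ∈-orbitList y) (λ {y} _ → ∈-allFin y)

  orbit-injective : ∀ {i j} → i < suc n → j < suc n → orbit i ≡ orbit j → i ≡ j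
  orbit-injective i< j< = Unique-map⇒InjectiveOn orbit orbitList-Unique (∈-upTo⁺ i<) (∈-upTo⁺ j<)

  orbit-returns : orbit (suc n) ≡ fzero
  orbit-returns with ∈-map⁻ orbit (∈-orbitList (orbit (suc n)))
  ... | zero , _ , eq = eq
  ... | suc j , j∈ , eq = ⊥-elim (<-irrefl (cong suc (sym n≡j)) (∈-upTo⁻ j∈))
    where
    n≡j : n ≡ j
    n≡j = orbit-injective (n<1+n n) (<-trans (n<1+n j) (∈-upTo⁻ j∈)) (Unique⇒lookup-injective σ (proj₁ circ) eq)

  orbit-nonzero : ∀ j → j < n → toℕ (orbit (suc j)) ≢ 0
  orbit-nonzero j j<n eq = 0≢1+n (sym (orbit-injective (s≤s j<n) (s≤s z≤n) (toℕ-injective eq)))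

  suc-cycleWord : ∀ j → j < n → suc (pred (toℕ (orbit (suc j)))) ≡ toℕ (orbit (suc j))
  suc-cycleWord j j<n = suc-pred _ {{≢-nonZero (orbit-nonzero j j<n)}}

  cycleWord∈perms : cycleWord σ ∈ perms n
  cycleWord∈perms = Unique∧All<⇒∈-perms
    (Unique.applyUpTo⁺₁ letter n (λ i<j j<n eq → <-irrefl (letter-injective (<-trans i<j j<n) j<n eq) i<j))
    (All.applyUpTo⁺₁ letter n (λ {j} j<n → subst (_≤ n) (sym (suc-cycleWord j j<n)) (≤-pred (toℕ<n (orbit (suc j))))))
    (length-applyUpTo letter n)
    where
    letter = λ i → pred (toℕ (orbit (suc i)))
    letter-injective : ∀ {i j} → i < n → j < n → letter i ≡ letter j → i ≡ j
    letter-injective {i} {j} i<n j<n eq = suc-injective (orbit-injective (s≤s i<n) (s≤s j<n) (toℕ-injective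
      (trans (sym (suc-cycleWord i i<n)) (trans (cong suc eq) (suc-cycleWord j j<n)))))

  lcdes≡largeDescents : lcdes σ ≡ largeDescents (cycleWord σ)
  lcdes≡largeDescents = begin
    length (filter large? (allFin (suc n)))
      ≡⟨ ↭-length (filter-↭ large? allFin↭orbitList) ⟩
    length (filter large? (map orbit (upTo (suc n))))
      ≡⟨ length-filter-map orbit large? (upTo (suc n)) ⟩
    length (filter (large? ∘ orbit) (upTo (suc n)))
      ≡⟨ length-filter-applyUpTo (large? ∘ orbit) id (suc n) ⟩
    #below (large? ∘ orbit) (suc n)
      ≡⟨⟩
    𝟙[ large? fzero ] + #below (large? ∘ orbit ∘ suc) n
      ≡⟨ cong (_+ #below (large? ∘ orbit ∘ suc) n) (𝟙-no (large? fzero) λ ()) ⟩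
    #below (large? ∘ orbit ∘ suc) n
      ≡⟨ #below-largeDescents n _ (λ j → toℕ (orbit (suc j)))
           (λ j j<n → sym (suc-cycleWord j j<n)) (cong toℕ orbit-returns) ⟩
    largeDescents (cycleWord σ) ∎
    where
    open ≡-Reasoning
    large? : (b : Fin (suc n)) → Dec (suc (toℕ (lookup σ b)) < toℕ b)
    large? b = suc (toℕ (lookup σ b)) <? toℕ b

-- 0 past the end of the word
lookup₀ : List ℕ → ℕ → ℕ
lookup₀ [] _ = 0
lookup₀ (x ∷ w) zero = x
lookup₀ (x ∷ w) (suc i) = lookup₀ w i

lookup₀-applyUpTo : ∀ (f : ℕ → ℕ) n i → i < n → lookup₀ (applyUpTo f n) i ≡ f i
lookup₀-applyUpTo f (suc n) zero _ = refl
lookup₀-applyUpTo f (suc n) (suc i) (s≤s i<n) = lookup₀-applyUpTo (f ∘ suc) n i i<n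

applyUpTo-lookup₀ : ∀ w → applyUpTo (lookup₀ w) (length w) ≡ w
applyUpTo-lookup₀ [] = refl
applyUpTo-lookup₀ (x ∷ w) = cong (x ∷_) (applyUpTo-lookup₀ w)

lookup₀-∈ : ∀ w i → i < length w → lookup₀ w i ∈ w
lookup₀-∈ (x ∷ w) zero _ = here refl
lookup₀-∈ (x ∷ w) (suc i) (s≤s i<) = there (lookup₀-∈ w i i<)

lookup₀-All : ∀ {P : ℕ → Set} w i → P 0 → All P w → P (lookup₀ w i)
lookup₀-All [] i p0 [] = p0
lookup₀-All (x ∷ w) zero _ (px ∷ _) = px
lookup₀-All (x ∷ w) (suc i) p0 (_ ∷ pw) = lookup₀-All w i p0 pw

lookup₀-length : ∀ w → lookup₀ w (length w) ≡ 0
lookup₀-length [] = refl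
lookup₀-length (x ∷ w) = lookup₀-length w

lookup₀-map-suc : ∀ w i → i < length w → lookup₀ (map suc w) i ≡ suc (lookup₀ w i)
lookup₀-map-suc (x ∷ w) zero _ = refl
lookup₀-map-suc (x ∷ w) (suc i) (s≤s i<) = lookup₀-map-suc w i i<

toℕ-lookup : ∀ {m n} (v : Vec (Fin m) n) i → toℕ (lookup v i) ≡ lookup₀ (word v) (toℕ i)
toℕ-lookup (x ∷ v) fzero = refl
toℕ-lookup (x ∷ v) (fsuc i) = toℕ-lookup v i

indexOf : List ℕ → ℕ → ℕ
indexOf [] v = 0
indexOf (x ∷ w) v with x ≟ℕ v
... | yes _ = 0
... | no _ = suc (indexOf w v)

indexOf-lookup₀ : ∀ w i → Unique w → i < length w → indexOf w (lookup₀ w i) ≡ i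
indexOf-lookup₀ (x ∷ w) zero _ _ with x ≟ℕ x
... | yes _ = refl
... | no x≢x = ⊥-elim (x≢x refl)
indexOf-lookup₀ (x ∷ w) (suc i) (x∉ ∷ u) (s≤s i<) with x ≟ℕ lookup₀ w i
... | yes x≡ = ⊥-elim (All.lookup x∉ (lookup₀-∈ w i i<) x≡)
... | no _ = cong suc (indexOf-lookup₀ w i u i<)

lookup₀-indexOf : ∀ w v → v ∈ w → lookup₀ w (indexOf w v) ≡ v
lookup₀-indexOf (x ∷ w) v v∈ with x ≟ℕ v
... | yes x≡v = x≡v
lookup₀-indexOf (x ∷ w) v (here v≡x) | no x≢v = ⊥-elim (x≢v (sym v≡x))
lookup₀-indexOf (x ∷ w) v (there v∈) | no _ = lookup₀-indexOf w v v∈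

indexOf<length : ∀ w v → v ∈ w → indexOf w v < length w
indexOf<length (x ∷ w) v v∈ with x ≟ℕ v
... | yes _ = s≤s z≤n
indexOf<length (x ∷ w) v (here v≡x) | no x≢v = ⊥-elim (x≢v (sym v≡x))
indexOf<length (x ∷ w) v (there v∈) | no _ = s≤s (indexOf<length w v v∈)

applyUpTo-cong : ∀ {A : Set} {f g : ℕ → A} n → (∀ i → i < n → f i ≡ g i) → applyUpTo f n ≡ applyUpTo g n
applyUpTo-cong zero _ = refl
applyUpTo-cong (suc n) f≡g = cong₂ _∷_ (f≡g 0 (s≤s z≤n)) (applyUpTo-cong n (λ i i< → f≡g (suc i) (s≤s i<)))

cycleWord-injective : ∀ {n} (σ τ : Vec (Fin (suc n)) (suc n)) → IsCircular σ → IsCircular τ →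
  cycleWord σ ≡ cycleWord τ → σ ≡ τ
cycleWord-injective {n} σ τ circσ circτ eq =
  trans (sym (Vec.tabulate∘lookup σ)) (trans (Vec.tabulate-cong lookup≡) (Vec.tabulate∘lookup τ))
  where
  module S = Circular σ circσ
  module T = Circular τ circτ
  letter≡ : ∀ i → i < n → toℕ (S.orbit (suc i)) ≡ toℕ (T.orbit (suc i))
  letter≡ i i<n = begin
    toℕ (S.orbit (suc i))                          ≡⟨ S.suc-cycleWord i i<n ⟨
    suc (pred (toℕ (S.orbit (suc i))))             ≡⟨ cong suc (lookup₀-applyUpTo _ n i i<n) ⟨
    suc (lookup₀ (cycleWord σ) i)                  ≡⟨ cong (λ u → suc (lookup₀ u i)) eq ⟩
    suc (lookup₀ (cycleWord τ) i)                  ≡⟨ cong suc (lookup₀-applyUpTo _ n i i<n) ⟩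
    suc (pred (toℕ (T.orbit (suc i))))             ≡⟨ T.suc-cycleWord i i<n ⟩
    toℕ (T.orbit (suc i))                          ∎
    where open ≡-Reasoning
  orbit≡ : ∀ i → i ≤ suc n → S.orbit i ≡ T.orbit i
  orbit≡ zero _ = refl
  orbit≡ (suc i) (s≤s i≤n) with m≤n⇒m<n∨m≡n i≤n
  ... | inj₁ i<n = toℕ-injective (letter≡ i i<n)
  ... | inj₂ refl = trans S.orbit-returns (sym T.orbit-returns)
  lookup≡ : ∀ b → lookup σ b ≡ lookup τ b
  lookup≡ b with ∈-map⁻ S.orbit (S.∈-orbitList b)
  ... | i , i∈ , refl = trans (orbit≡ (suc i) (∈-upTo⁻ i∈)) (cong (lookup τ) (sym (orbit≡ i (<⇒≤ (∈-upTo⁻ i∈)))))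

module CycleOfWord {n : ℕ} (w : List ℕ) (w∈ : w ∈ perms n) where

  cycle : List ℕ
  cycle = 0 ∷ map suc w

  length-cycle : length cycle ≡ suc n
  length-cycle = cong suc (trans (length-map suc w) (∈-perms⇒length w∈))

  cycle-Unique : Unique cycle
  cycle-Unique = All.map⁺ (All.tabulate (λ _ ())) ∷ Unique.map⁺ suc-injective (∈-perms⇒Unique {n} w∈)

  ∈-cycle : ∀ v → v < suc n → v ∈ cycle
  ∈-cycle zero _ = here refl
  ∈-cycle (suc v) (s≤s v<n) = there (∈-map⁺ suc (∈-resp-↭ (↭-sym (∈-perms⇒↭ w∈)) (∈-downFrom⁺ v<n)))

  -- past the last letter lookup₀ returns 0, the first letter of the cycle
  next : ℕ → ℕ
  next v = lookup₀ cycle (suc (indexOf cycle v))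

  next< : ∀ v → next v < suc n
  next< v = lookup₀-All {_< suc n} cycle (suc (indexOf cycle v)) (s≤s z≤n)
    (s≤s z≤n ∷ All.map⁺ (All.map s≤s (∈-perms⇒All< w∈)))

  σ-spec : ∃ λ (σ : Vec (Fin (suc n)) (suc n)) → word σ ≡ applyUpTo next (suc n)
  σ-spec = word-surjective _ (All.applyUpTo⁺₂ next (suc n) next<) (length-applyUpTo next (suc n))

  σ : Vec (Fin (suc n)) (suc n)
  σ = proj₁ σ-spec

  toℕ-lookup-σ : ∀ b → toℕ (lookup σ b) ≡ next (toℕ b)
  toℕ-lookup-σ b = trans (toℕ-lookup σ b)
    (trans (cong (λ u → lookup₀ u (toℕ b)) (proj₂ σ-spec)) (lookup₀-applyUpTo next (suc n) (toℕ b) (toℕ<n b)))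

  orbit : ℕ → Fin (suc n)
  orbit i = iter σ i fzero

  toℕ-orbit : ∀ i → i ≤ suc n → toℕ (orbit i) ≡ lookup₀ cycle i
  toℕ-orbit zero _ = refl
  toℕ-orbit (suc i) (s≤s i≤n) = begin
    toℕ (lookup σ (orbit i))                   ≡⟨ toℕ-lookup-σ (orbit i) ⟩
    next (toℕ (orbit i))                       ≡⟨ cong next (toℕ-orbit i (≤-trans i≤n (n≤1+n n))) ⟩
    next (lookup₀ cycle i)                     ≡⟨ cong (lookup₀ cycle ∘ suc) (indexOf-lookup₀ cycle i cycle-Unique i<) ⟩
    lookup₀ cycle (suc i)                      ∎
    where
    open ≡-Reasoning
    i< : i < length cycle
    i< = subst (i <_) (sym length-cycle) (s≤s i≤n)

  position : Fin (suc n) → ℕ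
  position y = indexOf cycle (toℕ y)

  position< : ∀ y → position y < suc n
  position< y = subst (position y <_) length-cycle (indexOf<length cycle (toℕ y) (∈-cycle (toℕ y) (toℕ<n y)))

  orbit-position : ∀ y → orbit (position y) ≡ y
  orbit-position y = toℕ-injective (trans (toℕ-orbit (position y) (<⇒≤ (position< y)))
    (lookup₀-indexOf cycle (toℕ y) (∈-cycle (toℕ y) (toℕ<n y))))

  orbit-returns : orbit (suc n) ≡ fzero
  orbit-returns = toℕ-injective (trans (toℕ-orbit (suc n) ≤-refl)
    (subst (λ m → lookup₀ cycle m ≡ 0) length-cycle (lookup₀-length cycle)))

  ∈-toList-σ : ∀ y → y ∈ toList σ
  ∈-toList-σ y with position y | orbit-position y
  ... | zero | refl = subst (_∈ toList σ) orbit-returns (∈-toList⁺ (∈-lookup (orbit n) σ))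
  ... | suc i | refl = ∈-toList⁺ (∈-lookup (orbit i) σ)

  circular : IsCircular σ
  circular = perm , All.tabulate (λ {y} _ → reached y)
    where
    reached : ∀ y → Any (λ i → orbit i ≡ y) (upTo (suc n))
    reached y = Any.map (λ { refl → orbit-position y }) (∈-upTo⁺ (position< y))
    perm : IsPerm σ
    perm = ⊇∧length≤⇒Unique _≟ᶠ_ (Unique.allFin⁺ (suc n)) (λ {y} _ → ∈-toList-σ y)
             (≤-reflexive (trans (Vec.length-toList σ) (sym (length-tabulate id))))

  cycleWord≡w : cycleWord σ ≡ w
  cycleWord≡w = begin
    applyUpTo (λ i → pred (toℕ (orbit (suc i)))) n   ≡⟨ applyUpTo-cong n letter≡ ⟩
    applyUpTo (lookup₀ w) n                          ≡⟨ cong (applyUpTo (lookup₀ w)) (∈-perms⇒length w∈) ⟨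
    applyUpTo (lookup₀ w) (length w)                 ≡⟨ applyUpTo-lookup₀ w ⟩
    w                                                ∎
    where
    open ≡-Reasoning
    letter≡ : ∀ i → i < n → pred (toℕ (orbit (suc i))) ≡ lookup₀ w i
    letter≡ i i<n = cong pred (trans (toℕ-orbit (suc i) (s≤s (<⇒≤ i<n)))
      (lookup₀-map-suc w i (subst (i <_) (sym (∈-perms⇒length w∈)) i<n)))

circCount≡#perms-largeDescents : ∀ n k → circCount n k ≡ #perms-with largeDescents n k
circCount≡#perms-largeDescents n k =
  length-≡-by-bijection cycleWord (Unique.filter⁺ P? (allMaps-Unique (suc n))) (Unique.filter⁺ Q? (perms-Unique n))
    injective into onto
  where
  P? = λ (σ : Vec (Fin (suc n)) (suc n)) → isCircular? σ ×-dec (lcdes σ ≟ℕ k)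
  Q? = λ w → largeDescents w ≟ℕ k
  circular : ∀ {σ} → σ ∈ filter P? (allMaps (suc n)) → IsCircular σ
  circular σ∈ = proj₁ (proj₂ (∈-filter⁻ P? {xs = allMaps (suc n)} σ∈))
  injective : InjectiveOn cycleWord (filter P? (allMaps (suc n)))
  injective σ∈ τ∈ = cycleWord-injective _ _ (circular σ∈) (circular τ∈)
  into : ∀ {σ} → σ ∈ filter P? (allMaps (suc n)) → cycleWord σ ∈ filter Q? (perms n)
  into {σ} σ∈ with ∈-filter⁻ P? {xs = allMaps (suc n)} σ∈
  ... | _ , circ , lcdes≡k =
    ∈-filter⁺ Q? (Circular.cycleWord∈perms σ circ) (trans (sym (Circular.lcdes≡largeDescents σ circ)) lcdes≡k)
  onto : ∀ {w} → w ∈ filter Q? (perms n) → ∃ λ σ → σ ∈ filter P? (allMaps (suc n)) × cycleWord σ ≡ w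
  onto {w} w∈ with ∈-filter⁻ Q? {xs = perms n} w∈
  ... | w∈perms , large≡k =
    F.σ , ∈-filter⁺ P? (∈-allMaps (suc n) F.σ) (F.circular , lcdes≡k) , F.cycleWord≡w
    where
    module F = CycleOfWord {n} w w∈perms
    lcdes≡k : lcdes F.σ ≡ k
    lcdes≡k = trans (Circular.lcdes≡largeDescents F.σ F.circular) (trans (cong largeDescents F.cycleWord≡w) large≡k)

theorem4p5 : (n k : ℕ) → circCount n k ≡ eulerian n k
theorem4p5 n k = begin
  circCount n k                     ≡⟨ circCount≡#perms-largeDescents n k ⟩
  #perms-with largeDescents n k     ≡⟨ #perms-descents≡#perms-largeDescents n k ⟨
  #perms-with descents n k          ≡⟨ eulerian≡#perms-descents n k ⟨
  eulerian n k                      ∎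
  where open ≡-Reasoning
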